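{- Let $\beta,\gamma$ be integers. For $(u,v)\in\mathbb R^2$ let $M_{\beta,\gamma}(u,v)=M_{\beta,\gamma}(u^2-v^2,\,2uv,\,u^2+v^2)$, where for $(x,y,z)\in\mathbb R^3$ $$M_{\beta,\gamma}(x,y,z)=\begin{pmatrix} (\gamma^2-\gamma +1-\beta^2)(x - z)+\beta y + z & \beta (x - z) - \gamma y & (\beta^2-\gamma^2+\gamma) (x - z)-\beta y \\ -\beta(2\gamma-1)(x - z) +\gamma y & \gamma (x-z)+\beta y+z & \beta(2\gamma-1)(x - z)+(1-\gamma)y \\ (\beta^2+\gamma^2-\gamma) (x - z)-\beta y & -\beta(x - z)+(1-\gamma)y & -( \beta^2+\gamma^2-\gamma)(x - z)+\beta y + z \end{pmatrix}.$$ Define on $\mathbb R^2$ the product $(u,v)*_{\beta,\gamma}(s,t)=(su+tv(1-2\gamma),\ tu+sv+2\beta tv)$, and let $(u,v)^{n_{*}}$ denote the $n$-th power of $(u,v)$ with respect to $*_{\beta,\gamma}$. Then for every $(u,v)\in\mathbb R^2$ and every positive integer $n$, $$(M_{\beta,\gamma}(u,v))^n=M_{\beta,\gamma}\big((u,v)^{n_{*}}\big).$$ Consequently, powers of matrices of the form $M_{\beta,\gamma}(u,v)$ are again of this form.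
   Context: Matrix powers are with respect to the usual matrix product. -}

module Defs where

open import Level using (Level)
open import Algebra.Bundles using (CommutativeRing)
open import Data.Nat using (ℕ; zero; suc)
open import Data.Integer using (ℤ; +_; -[1+_])
open import Data.Fin using (Fin; zero; suc)
open import Data.Product using (_×_; _,_)

-- Everything is developed over an arbitrary commutative ring R
-- (the paper's case is R = ℝ).
module _ {c ℓ : Level} (R : CommutativeRing c ℓ) where
  open CommutativeRing R hiding (zero)

  ℕ⇒R : ℕ → Carrier
  ℕ⇒R zero    = 0#
  ℕ⇒R (suc n) = 1# + ℕ⇒R n

  ℤ⇒R : ℤ → Carrier
  ℤ⇒R (+ n)      = ℕ⇒R n
  ℤ⇒R -[1+ n ]   = - (1# + ℕ⇒R n)

  Mat3 : Set c
  Mat3 = Fin 3 → Fin 3 → Carrier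

  _≋_ : Mat3 → Mat3 → Set ℓ
  A ≋ B = ∀ i j → A i j ≈ B i j

  _·_ : Mat3 → Mat3 → Mat3
  (A · B) i j = A i zero * B zero j + A i (suc zero) * B (suc zero) j
                  + A i (suc (suc zero)) * B (suc (suc zero)) j

  I₃ : Mat3
  I₃ zero zero = 1#
  I₃ (suc zero) (suc zero) = 1#
  I₃ (suc (suc zero)) (suc (suc zero)) = 1#
  I₃ _ _ = 0#

  mpow : Mat3 → ℕ → Mat3
  mpow A zero    = I₃
  mpow A (suc n) = mpow A n · A

  Mxyz : ℤ → ℤ → Carrier → Carrier → Carrier → Mat3
  Mxyz β' γ' x y z = m
    where
    β = ℤ⇒R β'
    γ = ℤ⇒R γ'
    d = x - z
    m : Mat3
    m zero zero = (γ * γ - γ + 1# - β * β) * d + β * y + z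
    m zero (suc zero) = β * d - γ * y
    m zero (suc (suc zero)) = (β * β - γ * γ + γ) * d - β * y
    m (suc zero) zero = - (β * (ℕ⇒R 2 * γ - 1#)) * d + γ * y
    m (suc zero) (suc zero) = γ * d + β * y + z
    m (suc zero) (suc (suc zero)) = β * (ℕ⇒R 2 * γ - 1#) * d + (1# - γ) * y
    m (suc (suc zero)) zero = (β * β + γ * γ - γ) * d - β * y
    m (suc (suc zero)) (suc zero) = - β * d + (1# - γ) * y
    m (suc (suc zero)) (suc (suc zero)) = - (β * β + γ * γ - γ) * d + β * y + z

  Muv : ℤ → ℤ → Carrier × Carrier → Mat3
  Muv β γ (u , v) = Mxyz β γ (u * u - v * v) (ℕ⇒R 2 * u * v) (u * u + v * v)

  star : ℤ → ℤ → Carrier × Carrier → Carrier × Carrier → Carrier × Carrier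
  star β' γ' (u , v) (s , t) =
    (s * u + t * v * (1# - ℕ⇒R 2 * γ) , t * u + s * v + ℕ⇒R 2 * β * t * v)
    where
    β = ℤ⇒R β'
    γ = ℤ⇒R γ'

  -- n-th *-power for n ≥ 1 (x^1 = x, x^(n+1) = x^n * x); the n = 0
  -- value (1,0), which is the unit of *, is never used by the theorem.
  starPow : ℤ → ℤ → Carrier × Carrier → ℕ → Carrier × Carrier
  starPow β γ p zero          = (1# , 0#)
  starPow β γ p (suc zero)    = p
  starPow β γ p (suc (suc n)) = star β γ (starPow β γ p (suc n)) p

{-# OPTIONS --safe #-}

-- The entries of M_{β,γ}(u,v) are quadratic forms in (u,v), and a polynomial
-- computation in β, γ, u, v, s, t shows M(u,v) · M(s,t) = M((u,v) * (s,t)):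
-- p ↦ M(p) turns *-products into matrix products, so M(p)ⁿ = M(pⁿ) by
-- induction on n.  The identity holds over any commutative ring and is checked
-- by the ring solver with integer coefficients, which needs the canonical map
-- ℤ → R to be a ring homomorphism.
module Submission where

open import Defs
open import Level using (Level)
open import Algebra.Bundles using (CommutativeRing)
open import Data.Nat using (ℕ; _≤_)
open import Data.Integer using (ℤ)
open import Data.Product using (_×_; _,_)
open import Data.Nat as ℕ using (zero; suc)
open import Data.Integer as ℤ using (+_; -[1+_])
open import Data.Integer.Properties using ([1+m]⊖[1+n]≡m⊖n)
open import Data.Nat.Properties using (+-suc)
open import Data.Sign as Sign using ()
open import Data.Fin using (Fin; zero; suc)
open import Data.Maybe using (Maybe; just; nothing)
open import Relation.Nullary using (yes; no)
open import Relation.Binary.PropositionalEquality as ≡ using (_≡_)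
open import Algebra.Solver.Ring.AlmostCommutativeRing
  using (_-Raw-AlmostCommutative⟶_; fromCommutativeRing)
import Algebra.Solver.Ring as RingSolver

module _ {c ℓ : Level} (R : CommutativeRing c ℓ) where
  open CommutativeRing R hiding (zero)
  open import Relation.Binary.Reasoning.Setoid setoid
  open import Algebra.Properties.Ring ring
    using (-0#≈0#; -‿involutive; -‿+-comm; -‿distribˡ-*; -‿distribʳ-*)
  open import Algebra.Properties.Semiring.Mult semiring
    using (×-homo-+; ×1-homo-*) renaming (_×_ to _×ℕ_)

  private
    ℕ⇒ = ℕ⇒R R
    ℤ⇒ = ℤ⇒R R

  ℕ⇒R≡×1# : ∀ n → ℕ⇒ n ≡ n ×ℕ 1#
  ℕ⇒R≡×1# zero    = ≡.refl
  ℕ⇒R≡×1# (suc n) = ≡.cong (λ x → 1# + x) (ℕ⇒R≡×1# n)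

  ℕ⇒R-homo-+ : ∀ m n → ℕ⇒ (m ℕ.+ n) ≈ ℕ⇒ m + ℕ⇒ n
  ℕ⇒R-homo-+ m n
    rewrite ℕ⇒R≡×1# (m ℕ.+ n) | ℕ⇒R≡×1# m | ℕ⇒R≡×1# n = ×-homo-+ 1# m n

  ℕ⇒R-homo-* : ∀ m n → ℕ⇒ (m ℕ.* n) ≈ ℕ⇒ m * ℕ⇒ n
  ℕ⇒R-homo-* m n
    rewrite ℕ⇒R≡×1# (m ℕ.* n) | ℕ⇒R≡×1# m | ℕ⇒R≡×1# n = ×1-homo-* m n

  1+x-[1+y]≈x-y : ∀ x y → (1# + x) - (1# + y) ≈ x - y
  1+x-[1+y]≈x-y x y = begin
    (1# + x) + - (1# + y)    ≈⟨ +-congˡ (-‿+-comm 1# y) ⟨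
    (1# + x) + (- 1# + - y)  ≈⟨ +-congʳ (+-comm 1# x) ⟩
    (x + 1#) + (- 1# + - y)  ≈⟨ +-assoc x 1# _ ⟩
    x + (1# + (- 1# + - y))  ≈⟨ +-congˡ (+-assoc 1# (- 1#) (- y)) ⟨
    x + ((1# - 1#) + - y)    ≈⟨ +-congˡ (+-congʳ (-‿inverseʳ 1#)) ⟩
    x + (0# + - y)           ≈⟨ +-congˡ (+-identityˡ (- y)) ⟩
    x - y                    ∎

  ℤ⇒R-homo-⊖ : ∀ m n → ℤ⇒ (m ℤ.⊖ n) ≈ ℕ⇒ m - ℕ⇒ n
  ℤ⇒R-homo-⊖ m zero = begin
    ℕ⇒ m       ≈⟨ +-identityʳ (ℕ⇒ m) ⟨
    ℕ⇒ m + 0#  ≈⟨ +-congˡ -0#≈0# ⟨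
    ℕ⇒ m - 0#  ∎
  ℤ⇒R-homo-⊖ zero (suc n) = sym (+-identityˡ _)
  ℤ⇒R-homo-⊖ (suc m) (suc n) = begin
    ℤ⇒ (suc m ℤ.⊖ suc n)     ≡⟨ ≡.cong ℤ⇒ ([1+m]⊖[1+n]≡m⊖n m n) ⟩
    ℤ⇒ (m ℤ.⊖ n)             ≈⟨ ℤ⇒R-homo-⊖ m n ⟩
    ℕ⇒ m - ℕ⇒ n              ≈⟨ 1+x-[1+y]≈x-y (ℕ⇒ m) (ℕ⇒ n) ⟨
    ℕ⇒ (suc m) - ℕ⇒ (suc n)  ∎

  ℤ⇒R-homo-+ : ∀ i j → ℤ⇒ (i ℤ.+ j) ≈ ℤ⇒ i + ℤ⇒ j
  ℤ⇒R-homo-+ (+ m)    (+ n)    = ℕ⇒R-homo-+ m n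
  ℤ⇒R-homo-+ (+ m)    -[1+ n ] = ℤ⇒R-homo-⊖ m (suc n)
  ℤ⇒R-homo-+ -[1+ m ] (+ n)    = trans (ℤ⇒R-homo-⊖ n (suc m)) (+-comm _ _)
  ℤ⇒R-homo-+ -[1+ m ] -[1+ n ] = begin
    - ℕ⇒ (suc (suc (m ℕ.+ n)))   ≡⟨ ≡.cong (λ k → - ℕ⇒ (suc k)) (+-suc m n) ⟨
    - ℕ⇒ (suc m ℕ.+ suc n)       ≈⟨ -‿cong (ℕ⇒R-homo-+ (suc m) (suc n)) ⟩
    - (ℕ⇒ (suc m) + ℕ⇒ (suc n))  ≈⟨ -‿+-comm _ _ ⟨
    - ℕ⇒ (suc m) - ℕ⇒ (suc n)    ∎

  ℤ⇒R-homo-‿- : ∀ i → ℤ⇒ (ℤ.- i) ≈ - ℤ⇒ i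
  ℤ⇒R-homo-‿- (+ zero)  = sym -0#≈0#
  ℤ⇒R-homo-‿- (+ suc n) = refl
  ℤ⇒R-homo-‿- -[1+ n ]  = sym (-‿involutive _)

  ℤ⇒R[+◃n] : ∀ n → ℤ⇒ (Sign.+ ℤ.◃ n) ≈ ℕ⇒ n
  ℤ⇒R[+◃n] zero    = refl
  ℤ⇒R[+◃n] (suc n) = refl

  ℤ⇒R[-◃n] : ∀ n → ℤ⇒ (Sign.- ℤ.◃ n) ≈ - ℕ⇒ n
  ℤ⇒R[-◃n] zero    = sym -0#≈0#
  ℤ⇒R[-◃n] (suc n) = refl

  ℤ⇒R-homo-* : ∀ i j → ℤ⇒ (i ℤ.* j) ≈ ℤ⇒ i * ℤ⇒ j
  ℤ⇒R-homo-* (+ m) (+ n) = trans (ℤ⇒R[+◃n] (m ℕ.* n)) (ℕ⇒R-homo-* m n)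
  ℤ⇒R-homo-* (+ m) -[1+ n ] = begin
    ℤ⇒ (Sign.- ℤ.◃ (m ℕ.* suc n))  ≈⟨ ℤ⇒R[-◃n] (m ℕ.* suc n) ⟩
    - ℕ⇒ (m ℕ.* suc n)             ≈⟨ -‿cong (ℕ⇒R-homo-* m (suc n)) ⟩
    - (ℕ⇒ m * ℕ⇒ (suc n))          ≈⟨ -‿distribʳ-* _ _ ⟩
    ℕ⇒ m * - ℕ⇒ (suc n)            ∎
  ℤ⇒R-homo-* -[1+ m ] (+ n) = begin
    ℤ⇒ (Sign.- ℤ.◃ (suc m ℕ.* n))  ≈⟨ ℤ⇒R[-◃n] (suc m ℕ.* n) ⟩
    - ℕ⇒ (suc m ℕ.* n)             ≈⟨ -‿cong (ℕ⇒R-homo-* (suc m) n) ⟩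
    - (ℕ⇒ (suc m) * ℕ⇒ n)          ≈⟨ -‿distribˡ-* _ _ ⟩
    - ℕ⇒ (suc m) * ℕ⇒ n            ∎
  ℤ⇒R-homo-* -[1+ m ] -[1+ n ] = begin
    ℤ⇒ (Sign.+ ℤ.◃ (suc m ℕ.* suc n))  ≈⟨ ℤ⇒R[+◃n] (suc m ℕ.* suc n) ⟩
    ℕ⇒ (suc m ℕ.* suc n)               ≈⟨ ℕ⇒R-homo-* (suc m) (suc n) ⟩
    ℕ⇒ (suc m) * ℕ⇒ (suc n)            ≈⟨ -‿involutive _ ⟨
    - - (ℕ⇒ (suc m) * ℕ⇒ (suc n))      ≈⟨ -‿cong (-‿distribʳ-* _ _) ⟩
    - (ℕ⇒ (suc m) * - ℕ⇒ (suc n))      ≈⟨ -‿distribˡ-* _ _ ⟩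
    - ℕ⇒ (suc m) * - ℕ⇒ (suc n)        ∎

  -- The solver evaluates the constant (+ 1) by this map; it must be 1# on
  -- the nose (not 1# + 0#) for the solver's terms to match Defs literally.
  ⟦_⟧ℤ : ℤ → Carrier
  ⟦ + 1 ⟧ℤ = 1#
  ⟦ i   ⟧ℤ = ℤ⇒ i

  ⟦⟧ℤ≈ℤ⇒R : ∀ i → ⟦ i ⟧ℤ ≈ ℤ⇒ i
  ⟦⟧ℤ≈ℤ⇒R (+ 0)             = refl
  ⟦⟧ℤ≈ℤ⇒R (+ 1)             = sym (+-identityʳ 1#)
  ⟦⟧ℤ≈ℤ⇒R (+ suc (suc n))   = refl
  ⟦⟧ℤ≈ℤ⇒R -[1+ n ]          = refl

  ℤ-coefficients : ℤ.+-*-rawRing -Raw-AlmostCommutative⟶ fromCommutativeRing R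
  ℤ-coefficients = record
    { ⟦_⟧    = ⟦_⟧ℤ
    ; +-homo = λ i j → transport (i ℤ.+ j) (ℤ⇒R-homo-+ i j) (+-cong (⟦⟧ℤ≈ℤ⇒R i) (⟦⟧ℤ≈ℤ⇒R j))
    ; *-homo = λ i j → transport (i ℤ.* j) (ℤ⇒R-homo-* i j) (*-cong (⟦⟧ℤ≈ℤ⇒R i) (⟦⟧ℤ≈ℤ⇒R j))
    ; -‿homo = λ i → transport (ℤ.- i) (ℤ⇒R-homo-‿- i) (-‿cong (⟦⟧ℤ≈ℤ⇒R i))
    ; 0-homo = refl
    ; 1-homo = refl
    }
    where
    transport : ∀ i {x y} → ℤ⇒ i ≈ x → y ≈ x → ⟦ i ⟧ℤ ≈ y
    transport i p q = trans (⟦⟧ℤ≈ℤ⇒R i) (trans p (sym q))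

  ℤ-equality : ∀ i j → Maybe (⟦ i ⟧ℤ ≈ ⟦ j ⟧ℤ)
  ℤ-equality i j with i ℤ.≟ j
  ... | yes ≡.refl = just refl
  ... | no _       = nothing

  open RingSolver ℤ.+-*-rawRing (fromCommutativeRing R) ℤ-coefficients ℤ-equality
    using (Polynomial; con; _:+_; _:*_; _:-_; :-_; _:=_; solve)

  private
    Mat = Mat3 R
    _≋′_ = _≋_ R
    _·′_ = _·_ R

  ≋-trans : ∀ {A B C : Mat} → A ≋′ B → B ≋′ C → A ≋′ C
  ≋-trans A≋B B≋C i j = trans (A≋B i j) (B≋C i j)

  ·-congʳ : ∀ {A A′ : Mat} B → A ≋′ A′ → (A ·′ B) ≋′ (A′ ·′ B)
  ·-congʳ B A≋A′ i j =
    +-cong (+-cong (*-congʳ (A≋A′ i zero)) (*-congʳ (A≋A′ i (suc zero))))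
           (*-congʳ (A≋A′ i (suc (suc zero))))

  0ᴾ 1ᴾ 2ᴾ : ∀ {n} → Polynomial n
  0ᴾ = con (+ 0)
  1ᴾ = con (+ 1)
  2ᴾ = con (+ 2)

  ·-identityˡ : ∀ A → (I₃ R ·′ A) ≋′ A
  ·-identityˡ A zero j =
    solve 3 (λ x y z → 1ᴾ :* x :+ 0ᴾ :* y :+ 0ᴾ :* z := x) refl
      (A zero j) (A (suc zero) j) (A (suc (suc zero)) j)
  ·-identityˡ A (suc zero) j =
    solve 3 (λ x y z → 0ᴾ :* x :+ 1ᴾ :* y :+ 0ᴾ :* z := y) refl
      (A zero j) (A (suc zero) j) (A (suc (suc zero)) j)
  ·-identityˡ A (suc (suc zero)) j =
    solve 3 (λ x y z → 0ᴾ :* x :+ 0ᴾ :* y :+ 1ᴾ :* z := z) refl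
      (A zero j) (A (suc zero) j) (A (suc (suc zero)) j)

  Matᴾ : Set
  Matᴾ = Fin 3 → Fin 3 → Polynomial 6

  _·ᴾ_ : Matᴾ → Matᴾ → Matᴾ
  (A ·ᴾ B) i j = A i zero :* B zero j :+ A i (suc zero) :* B (suc zero) j
                   :+ A i (suc (suc zero)) :* B (suc (suc zero)) j

  -- Mxyz and Muv transcribed into the solver's syntax; evaluated at
  -- ℤ⇒R β, ℤ⇒R γ, u, v they are Muv β γ (u , v) on the nose.
  Mxyzᴾ : (b g x y z : Polynomial 6) → Matᴾ
  Mxyzᴾ b g x y z = m
    where
    d = x :- z
    m : Matᴾ
    m zero zero = (g :* g :- g :+ 1ᴾ :- b :* b) :* d :+ b :* y :+ z
    m zero (suc zero) = b :* d :- g :* y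
    m zero (suc (suc zero)) = (b :* b :- g :* g :+ g) :* d :- b :* y
    m (suc zero) zero = :- (b :* (2ᴾ :* g :- 1ᴾ)) :* d :+ g :* y
    m (suc zero) (suc zero) = g :* d :+ b :* y :+ z
    m (suc zero) (suc (suc zero)) = b :* (2ᴾ :* g :- 1ᴾ) :* d :+ (1ᴾ :- g) :* y
    m (suc (suc zero)) zero = (b :* b :+ g :* g :- g) :* d :- b :* y
    m (suc (suc zero)) (suc zero) = :- b :* d :+ (1ᴾ :- g) :* y
    m (suc (suc zero)) (suc (suc zero)) = :- (b :* b :+ g :* g :- g) :* d :+ b :* y :+ z

  Muvᴾ : (b g u v : Polynomial 6) → Matᴾ
  Muvᴾ b g u v = Mxyzᴾ b g (u :* u :- v :* v) (2ᴾ :* u :* v) (u :* u :+ v :* v)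

  Muv-multiplicativeᴾ : Fin 3 → Fin 3 → (b g u v s t : Polynomial 6)
                      → Polynomial 6 × Polynomial 6
  Muv-multiplicativeᴾ i j b g u v s t =
    (Muvᴾ b g u v ·ᴾ Muvᴾ b g s t) i j
      := Muvᴾ b g (s :* u :+ t :* v :* (1ᴾ :- 2ᴾ :* g))
                  (t :* u :+ s :* v :+ 2ᴾ :* b :* t :* v) i j

  Muv-homo-star : ∀ β γ p q →
    (Muv R β γ p ·′ Muv R β γ q) ≋′ Muv R β γ (star R β γ p q)
  Muv-homo-star β γ (u , v) (s , t) = entry
    where
    β′ γ′ : Carrier
    β′ = ℤ⇒ β
    γ′ = ℤ⇒ γ

    entry : ∀ i j → (Muv R β γ (u , v) ·′ Muv R β γ (s , t)) i j
                    ≈ Muv R β γ (star R β γ (u , v) (s , t)) i j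
    entry zero zero =
      solve 6 (Muv-multiplicativeᴾ zero zero) refl β′ γ′ u v s t
    entry zero (suc zero) =
      solve 6 (Muv-multiplicativeᴾ zero (suc zero)) refl β′ γ′ u v s t
    entry zero (suc (suc zero)) =
      solve 6 (Muv-multiplicativeᴾ zero (suc (suc zero))) refl β′ γ′ u v s t
    entry (suc zero) zero =
      solve 6 (Muv-multiplicativeᴾ (suc zero) zero) refl β′ γ′ u v s t
    entry (suc zero) (suc zero) =
      solve 6 (Muv-multiplicativeᴾ (suc zero) (suc zero)) refl β′ γ′ u v s t
    entry (suc zero) (suc (suc zero)) =
      solve 6 (Muv-multiplicativeᴾ (suc zero) (suc (suc zero))) refl β′ γ′ u v s t
    entry (suc (suc zero)) zero =
      solve 6 (Muv-multiplicativeᴾ (suc (suc zero)) zero) refl β′ γ′ u v s t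
    entry (suc (suc zero)) (suc zero) =
      solve 6 (Muv-multiplicativeᴾ (suc (suc zero)) (suc zero)) refl β′ γ′ u v s t
    entry (suc (suc zero)) (suc (suc zero)) =
      solve 6 (Muv-multiplicativeᴾ (suc (suc zero)) (suc (suc zero))) refl β′ γ′ u v s t

  mpow-homo-starPow : ∀ β γ (φ : Carrier × Carrier → Mat) →
    (∀ p q → (φ p ·′ φ q) ≋′ φ (star R β γ p q)) →
    ∀ p n → mpow R (φ p) (suc n) ≋′ φ (starPow R β γ p (suc n))
  mpow-homo-starPow β γ φ φ-homo p zero = ·-identityˡ (φ p)
  mpow-homo-starPow β γ φ φ-homo p (suc n) =
    ≋-trans (·-congʳ (φ p) (mpow-homo-starPow β γ φ φ-homo p n))
            (φ-homo (starPow R β γ p (suc n)) p)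

mainTheorem4 : {c ℓ : Level} (R : CommutativeRing c ℓ) (β γ : ℤ)
    (u v : CommutativeRing.Carrier R) (n : ℕ) → 1 ≤ n →
    _≋_ R (mpow R (Muv R β γ (u , v)) n) (Muv R β γ (starPow R β γ (u , v) n))
mainTheorem4 R β γ u v (suc n) _ =
  mpow-homo-starPow R β γ (Muv R β γ) (Muv-homo-star R β γ) (u , v) n
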